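{- Let $H=P\cup C$ be an ordered graph on the vertex set $\{1,2,\dots,n\}$ (with its natural order) consisting of two vertex-disjoint subgraphs: a path $P$ whose endpoints are $1$ and $n$, and a cycle $C$. If $H$ is nest-free, then $C$ is an even cycle.
   Context: An ordered graph is a graph whose vertex set is linearly ordered. A nest is a pair of vertex-disjoint edges $e,f$ with $\min e<\min f$ and $\max e>\max f$; an ordered graph is nest-free if it contains no nest. -}

module Defs where

open import Data.Nat using (ℕ; zero; suc; _∸_; _≤_)
open import Data.Fin using (Fin; toℕ; inject₁; fromℕ) renaming (_<_ to _<ᶠ_; suc to fsuc; zero to fzero)
open import Data.Product using (Σ; _×_; ∃-syntax)
open import Data.Sum using (_⊎_)
open import Relation.Binary.PropositionalEquality using (_≡_; _≢_)
open import Relation.Nullary using (¬_)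
open import Function.Definitions using (Injective)

-- Ordered graphs on {1,…,n} are represented with vertex set Fin n, ordered by
-- the natural order of Fin (vertex i corresponds to toℕ i + 1).
-- A graph is given by an (arbitrary) adjacency relation; edges are
-- unordered pairs {u,v} with u ≢ v, we read E u v ⊎ E v u.

Rel : ℕ → Set₁
Rel n = Fin n → Fin n → Set

Sym : {n : ℕ} → Rel n → Rel n
Sym E u v = E u v ⊎ E v u

-- A nest: edges {a,b} and {c,d} with a < c < d < b (these are automatically
-- vertex-disjoint, and min{a,b}=a < c = min{c,d}, max{a,b}=b > d = max{c,d}).
Nest : {n : ℕ} → Rel n → Set
Nest {n} E = Σ (Fin n) λ a → Σ (Fin n) λ b → Σ (Fin n) λ c → Σ (Fin n) λ d →
  (a <ᶠ c) × (c <ᶠ d) × (d <ᶠ b) × Sym E a b × Sym E c d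

NestFree : {n : ℕ} → Rel n → Set
NestFree E = ¬ Nest E

PathEdge : {n k : ℕ} → (Fin (suc k) → Fin n) → Rel n
PathEdge {n} {k} p u v = Σ (Fin k) λ i → (p (inject₁ i) ≡ u) × (p (fsuc i) ≡ v)

CycleEdge : {n m : ℕ} → (Fin m → Fin n) → Rel n
CycleEdge {n} {m} c u v = Σ (Fin m) λ i → Σ (Fin m) λ j →
  (c i ≡ u) × (c j ≡ v) × ((toℕ j ≡ suc (toℕ i)) ⊎ ((toℕ i ≡ m ∸ 1) × (toℕ j ≡ 0)))

UnionEdge : {n k m : ℕ} → (Fin (suc k) → Fin n) → (Fin m → Fin n) → Rel n
UnionEdge p c u v = PathEdge p u v ⊎ CycleEdge c u v

Partition : {n k m : ℕ} → (Fin (suc k) → Fin n) → (Fin m → Fin n) → Set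
Partition {n} {k} {m} p c =
  (∀ (i : Fin (suc k)) (j : Fin m) → p i ≢ c j) ×
  (∀ (v : Fin n) → (Σ (Fin (suc k)) λ i → p i ≡ v) ⊎ (Σ (Fin m) λ j → c j ≡ v))

{-# OPTIONS --safe #-}
module Submission where

-- Colour a vertex x by the parity of the number of path edges lying entirely
-- below x.  For a cycle edge uv with u < v, a path edge lying below v but not
-- below u either crosses u or lies inside (u, v); the latter is a nest, and so
-- is a path edge crossing u whose upper end exceeds v.  Hence the colours of u
-- and v differ by the parity of the number of path edges crossing u, which is
-- odd because the path runs from the first vertex to the last.  The cycle is
-- therefore properly 2-coloured, so it is even.

open import Defs
open import Data.Nat using (ℕ; suc; _∸_; _≤_)
open import Data.Nat.Divisibility using (_∣_)
open import Data.Fin using (Fin; toℕ; fromℕ) renaming (zero to fzero)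
open import Relation.Binary.PropositionalEquality using (_≡_)
open import Function.Definitions using (Injective)

open import Algebra.Bundles using (CommutativeRing)
open import Data.Bool using (Bool; true; false; _∧_; _xor_)
open import Data.Bool.Properties
  using (xor-∧-commutativeRing; xor-same; xor-comm; ∧-comm; ¬-not; not-involutive)
open import Data.Empty using (⊥-elim)
open import Data.Fin using (inject₁) renaming (suc to fsuc)
open import Data.Fin.Properties as Fin
  using (toℕ-injective; toℕ-inject₁; toℕ-fromℕ; toℕ≤pred[n]; ≤̄⇒inject₁<)
open import Data.Nat using (zero; _<_; _<?_; s≤s)
open import Data.Nat.Divisibility using (∣-refl; _∣0; ∣m∣n⇒∣m+n)
open import Data.Nat.Properties using (<-cmp; <-trans; ≤∧≢⇒<; ≮⇒≥; ≤⇒≯; n≢0⇒n>0)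
open import Data.Product using (_,_; _×_; proj₁; proj₂)
open import Data.Sum using (inj₁; inj₂; swap)
open import Function using (_∘_)
open import Relation.Binary.Definitions using (tri<; tri≈; tri>)
open import Relation.Binary.PropositionalEquality
  using (_≢_; refl; sym; trans; cong; cong₂; subst; ≢-sym; module ≡-Reasoning)
open import Relation.Nullary using (¬_; yes; no)
open import Relation.Nullary.Decidable using (⌊_⌋; isYes≗does; dec-true; dec-false)

open import Algebra.Properties.CommutativeMonoid.Sum
  (CommutativeRing.+-commutativeMonoid xor-∧-commutativeRing)
  using (sum; ∑-distrib-+; sum-cong-≗)

open ≡-Reasoning

xor-cancel-middle : ∀ x y z → (x xor y) xor (y xor z) ≡ x xor z
xor-cancel-middle false false z = refl
xor-cancel-middle false true  z = not-involutive z
xor-cancel-middle true  false z = refl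
xor-cancel-middle true  true  z = refl

xor≡true⇒≢ : ∀ {x y} → x xor y ≡ true → x ≢ y
xor≡true⇒≢ {false} () refl
xor≡true⇒≢ {true}  () refl

xor-telescope : ∀ {k} (f : Fin (suc k) → Bool) →
  sum (λ i → f (inject₁ i) xor f (fsuc i)) ≡ f fzero xor f (fromℕ k)
xor-telescope {zero}  f = sym (xor-same (f fzero))
xor-telescope {suc k} f =
  trans (cong ((f fzero xor f (fsuc fzero)) xor_) (xor-telescope (f ∘ fsuc)))
        (xor-cancel-middle (f fzero) (f (fsuc fzero)) (f (fromℕ (suc k))))

inject₁≢suc : ∀ {k} (i : Fin k) → inject₁ i ≢ fsuc i
inject₁≢suc i = Fin.<⇒≢ (≤̄⇒inject₁< (Fin.≤-refl {x = i}))

alternating-parity : ∀ {m} (g : Fin (suc m) → Bool) → (∀ i → g (inject₁ i) ≢ g (fsuc i)) →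
  (g fzero ≡ g (fromℕ m) → 2 ∣ m) × (g fzero ≢ g (fromℕ m) → 2 ∣ suc m)
alternating-parity {zero}  g _          = (λ _ → 2 ∣0) , (λ g₀≢g₀ → ⊥-elim (g₀≢g₀ refl))
alternating-parity {suc m} g alternates = even , odd
  where
  last-step : g (inject₁ (fromℕ m)) ≢ g (fromℕ (suc m))
  last-step = alternates (fromℕ m)

  even′ : g fzero ≡ g (inject₁ (fromℕ m)) → 2 ∣ m
  even′ = proj₁ (alternating-parity (g ∘ inject₁) (alternates ∘ inject₁))

  odd′ : g fzero ≢ g (inject₁ (fromℕ m)) → 2 ∣ suc m
  odd′ = proj₂ (alternating-parity (g ∘ inject₁) (alternates ∘ inject₁))

  even : g fzero ≡ g (fromℕ (suc m)) → 2 ∣ suc m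
  even g₀≡gₑ = odd′ (λ g₀≡g′ → last-step (trans (sym g₀≡g′) g₀≡gₑ))

  odd : g fzero ≢ g (fromℕ (suc m)) → 2 ∣ suc (suc m)
  odd g₀≢gₑ = ∣m∣n⇒∣m+n {2} ∣-refl
    (even′ (trans (¬-not g₀≢gₑ) (sym (¬-not last-step))))

below : ℕ → ℕ → ℕ → Bool
below x a b = ⌊ a <? x ⌋ ∧ ⌊ b <? x ⌋

separates : ℕ → ℕ → ℕ → Bool
separates x a b = ⌊ a <? x ⌋ xor ⌊ b <? x ⌋

Encloses : ℕ → ℕ → ℕ → ℕ → Set
Encloses a b c d = a < c × c < d × d < b

below-xor-below-ordered : ∀ {a b u v} → u < v → a < b → a ≢ u → b ≢ v →
  ¬ Encloses a b u v → ¬ Encloses u v a b →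
  below v a b xor below u a b ≡ separates u a b
below-xor-below-ordered {a} {b} {u} {v} u<v a<b a≢u b≢v ab⊐uv uv⊐ab
  with a <? u | b <? u | a <? v | b <? v
... | yes _   | yes _   | yes _   | yes _   = refl
... | yes a<u | _       | no a≮v  | _       = ⊥-elim (a≮v (<-trans a<u u<v))
... | _       | yes b<u | _       | no b≮v  = ⊥-elim (b≮v (<-trans b<u u<v))
... | no a≮u  | yes b<u | _       | _       = ⊥-elim (a≮u (<-trans a<b b<u))
... | yes _   | no _    | yes _   | yes _   = refl
... | yes a<u | no _    | yes _   | no b≮v  =
  ⊥-elim (ab⊐uv (a<u , u<v , ≤∧≢⇒< (≮⇒≥ b≮v) (≢-sym b≢v)))
... | no a≮u  | no _    | yes _   | yes b<v =
  ⊥-elim (uv⊐ab (≤∧≢⇒< (≮⇒≥ a≮u) (≢-sym a≢u) , a<b , b<v))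
... | no _    | no _    | yes _   | no _    = refl
... | no _    | no _    | no _    | _       = refl

below-xor-below : ∀ {a b u v} → u < v → a ≢ b → a ≢ u → a ≢ v → b ≢ u → b ≢ v →
  ¬ Encloses a b u v → ¬ Encloses b a u v → ¬ Encloses u v a b → ¬ Encloses u v b a →
  below v a b xor below u a b ≡ separates u a b
below-xor-below {a} {b} {u} {v} u<v a≢b a≢u a≢v b≢u b≢v ab⊐uv ba⊐uv uv⊐ab uv⊐ba
  with <-cmp a b
... | tri< a<b _ _   = below-xor-below-ordered u<v a<b a≢u b≢v ab⊐uv uv⊐ab
... | tri≈ _ a≡b _   = ⊥-elim (a≢b a≡b)
... | tri> _ _ b<a   = begin
  below v a b xor below u a b  ≡⟨ cong₂ _xor_ (∧-comm ⌊ a <? v ⌋ _) (∧-comm ⌊ a <? u ⌋ _) ⟩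
  below v b a xor below u b a  ≡⟨ below-xor-below-ordered u<v b<a b≢u a≢v ba⊐uv uv⊐ba ⟩
  separates u b a              ≡⟨ xor-comm ⌊ b <? u ⌋ _ ⟩
  separates u a b              ∎

edges-below : ∀ {k} → (Fin (suc k) → ℕ) → ℕ → Bool
edges-below s x = sum λ i → below x (s (inject₁ i)) (s (fsuc i))

edges-below-flips : ∀ {k} (s : Fin (suc k) → ℕ) {u v} → s fzero < u → ¬ s (fromℕ k) < u →
  (∀ i → below v (s (inject₁ i)) (s (fsuc i)) xor below u (s (inject₁ i)) (s (fsuc i))
           ≡ separates u (s (inject₁ i)) (s (fsuc i))) →
  edges-below s v xor edges-below s u ≡ true
edges-below-flips {k} s {u} {v} s₀<u sₖ≮u edge-flips = begin
  edges-below s v xor edges-below s u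
    ≡⟨ sym (∑-distrib-+ (λ i → below v (s (inject₁ i)) (s (fsuc i))) _) ⟩
  sum (λ i → below v (s (inject₁ i)) (s (fsuc i)) xor below u (s (inject₁ i)) (s (fsuc i)))
    ≡⟨ sum-cong-≗ edge-flips ⟩
  sum (λ i → separates u (s (inject₁ i)) (s (fsuc i)))
    ≡⟨ xor-telescope (λ j → ⌊ s j <? u ⌋) ⟩
  ⌊ s fzero <? u ⌋ xor ⌊ s (fromℕ k) <? u ⌋
    ≡⟨ cong₂ _xor_ (trans (isYes≗does (s fzero <? u)) (dec-true (s fzero <? u) s₀<u))
                   (trans (isYes≗does (s (fromℕ k) <? u)) (dec-false (s (fromℕ k) <? u) sₖ≮u)) ⟩
  true ∎

module PathAndCycle {n k m} (p : Fin (suc k) → Fin n) (c : Fin (suc m) → Fin n)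
  (p-injective : Injective _≡_ _≡_ p)
  (p-first : toℕ (p fzero) ≡ 0) (p-last : toℕ (p (fromℕ k)) ≡ n ∸ 1)
  (disjoint : ∀ i j → p i ≢ c j) (nest-free : NestFree (UnionEdge p c)) where

  H : Rel n
  H = UnionEdge p c

  OffPath : Fin n → Set
  OffPath x = ∀ i → p i ≢ x

  off-path-toℕ : ∀ {x} → OffPath x → ∀ i → toℕ (p i) ≢ toℕ x
  off-path-toℕ x-off i = x-off i ∘ toℕ-injective

  unnested : ∀ {a b x y} → Sym H a b → Sym H x y → ¬ Encloses (toℕ a) (toℕ b) (toℕ x) (toℕ y)
  unnested ab xy (a<x , x<y , y<b) = nest-free (_ , _ , _ , _ , a<x , x<y , y<b , ab , xy)

  path-edge : ∀ i → Sym H (p (inject₁ i)) (p (fsuc i))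
  path-edge i = inj₁ (inj₁ (i , refl , refl))

  cycle-edge : ∀ i → Sym H (c (inject₁ i)) (c (fsuc i))
  cycle-edge i =
    inj₁ (inj₂ (inject₁ i , fsuc i , refl , refl , inj₁ (cong suc (sym (toℕ-inject₁ i)))))

  closing-edge : Sym H (c (fromℕ m)) (c fzero)
  closing-edge = inj₁ (inj₂ (fromℕ m , fzero , refl , refl , inj₂ (toℕ-fromℕ m , refl)))

  colour : Fin n → Bool
  colour x = edges-below (toℕ ∘ p) (toℕ x)

  colour-flips : ∀ {u v} → toℕ u < toℕ v → Sym H u v → OffPath u → OffPath v →
    colour v xor colour u ≡ true
  colour-flips {u} {v} u<v uv u-off v-off =
    edges-below-flips (toℕ ∘ p) {v = toℕ v} starts-below ends-above
    λ i → below-xor-below u<v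
      (λ e → inject₁≢suc i (p-injective (toℕ-injective e)))
      (off-path-toℕ u-off _) (off-path-toℕ v-off _) (off-path-toℕ u-off _) (off-path-toℕ v-off _)
      (unnested (path-edge i) uv) (unnested (swap (path-edge i)) uv)
      (unnested uv (path-edge i)) (unnested uv (swap (path-edge i)))
    where
    starts-below : toℕ (p fzero) < toℕ u
    starts-below = subst (_< toℕ u) (sym p-first)
      (n≢0⇒n>0 (λ u≡0 → off-path-toℕ u-off fzero (trans p-first (sym u≡0))))

    ends-above : ¬ toℕ (p (fromℕ k)) < toℕ u
    ends-above = subst (λ x → ¬ x < toℕ u) (sym p-last) (≤⇒≯ (toℕ≤pred[n] u))

  colour-proper : ∀ {u v} → u ≢ v → Sym H u v → OffPath u → OffPath v → colour u ≢ colour v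
  colour-proper {u} {v} u≢v uv u-off v-off with <-cmp (toℕ u) (toℕ v)
  ... | tri< u<v _ _ = ≢-sym (xor≡true⇒≢ (colour-flips u<v uv u-off v-off))
  ... | tri≈ _ u≡v _ = ⊥-elim (u≢v (toℕ-injective u≡v))
  ... | tri> _ _ v<u = xor≡true⇒≢ (colour-flips v<u (swap uv) v-off u-off)

lemma4p4 : (n k m : ℕ) → (p : Fin (suc k) → Fin n) → (c : Fin m → Fin n) →
    Injective _≡_ _≡_ p → Injective _≡_ _≡_ c → 3 ≤ m →
    toℕ (p fzero) ≡ 0 → toℕ (p (fromℕ k)) ≡ n ∸ 1 →
    Partition p c → NestFree (UnionEdge p c) → 2 ∣ m
lemma4p4 n k (suc zero) _ _ _ _ (s≤s ()) _ _ _ _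
lemma4p4 n k (suc (suc m)) p c p-injective c-injective _ p-first p-last (disjoint , _) nest-free =
  proj₂ (alternating-parity (colour ∘ c) alternates) (≢-sym closes)
  where
  open PathAndCycle p c p-injective p-first p-last disjoint nest-free

  alternates : ∀ i → colour (c (inject₁ i)) ≢ colour (c (fsuc i))
  alternates i = colour-proper (inject₁≢suc i ∘ c-injective) (cycle-edge i)
    (λ j → disjoint j (inject₁ i)) (λ j → disjoint j (fsuc i))

  closes : colour (c (fromℕ (suc m))) ≢ colour (c fzero)
  closes = colour-proper ((λ ()) ∘ c-injective) closing-edge
    (λ j → disjoint j (fromℕ (suc m))) (λ j → disjoint j fzero)
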